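{- Let $p$ be an odd prime with $p\ge 5$ such that $4p-1$ is prime, and let $q$ be an odd prime with $q<p$ and $\left(\frac{q}{4p-1}\right)=1$. Then the field $\mathbb{Q}(\sqrt{1-4p})$ has class number greater than $1$.
   Context: $\left(\frac{M}{P}\right)$ denotes the Legendre symbol for an integer $M$ and an odd prime $P$. -}

module Defs where

open import Data.Nat as ℕ using (ℕ)
open import Data.Integer using (ℤ; +_; _+_; _*_; _-_; 0ℤ; 1ℤ)
open import Data.Integer.Divisibility using () renaming (_∣_ to _∣ℤ_)
open import Data.Product using (_×_; _,_; ∃; Σ)
open import Relation.Binary.PropositionalEquality using (_≡_)
open import Relation.Nullary using (¬_)
open import Function.Bundles using (_⇔_)
open import Level using (Level; suc; zero)

LegendreIsOne : ℤ → ℕ → Set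
LegendreIsOne M P = ¬ ((+ P) ∣ℤ M) × ∃ λ (x : ℤ) → (+ P) ∣ℤ (x * x - M)

-- For p with 1 - 4p squarefree and ≡ 1 (mod 4) (e.g. 4p-1 prime), the ring of
-- integers of Q(√(1-4p)) is Z[ω], ω = (1 + √(1-4p))/2, with ω² = ω - p.
-- An element a + bω is represented by the pair (a , b).
O : Set
O = ℤ × ℤ

-- multiplication in Z[ω], parametrised by p:
-- (a + bω)(c + dω) = (ac - p·bd) + (ad + bc + bd)ω
mulO : ℕ → O → O → O
mulO p (a , b) (c , d) = (a * c - (+ p) * (b * d)) , (a * d + b * c + b * d)

addO : O → O → O
addO (a , b) (c , d) = (a + c) , (b + d)

zeroO : O
zeroO = (0ℤ , 0ℤ)

record Ideal (p : ℕ) : Set₁ where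
  field
    carrier : O → Set
    zero∈   : carrier zeroO
    +-closed : ∀ {x y} → carrier x → carrier y → carrier (addO x y)
    *-closed : ∀ r {x} → carrier x → carrier (mulO p r x)

IsPrincipal : {p : ℕ} → Ideal p → Set
IsPrincipal {p} I = ∃ λ (g : O) → ∀ (x : O) →
  Ideal.carrier I x ⇔ (∃ λ (r : O) → x ≡ mulO p r g)

-- class number of Q(√(1-4p)) is > 1  iff  the ideal class group is
-- nontrivial iff  some ideal of the ring of integers is not principal.
ClassNumberGT1 : ℕ → Set₁
ClassNumberGT1 p = Σ (Ideal p) λ I → ¬ IsPrincipal I

-- Write ℓ = 4p - 1 and ω = (1 + √-ℓ)/2, so that ω² = ω - p. As ℓ ≡ 3 (mod 4), quadratic
-- reciprocity turns (q/ℓ) = 1 into (-ℓ/q) = 1, so ω² - ω + p has a root -n modulo q and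
-- 𝔮 = (q, n + ω) is an ideal. If 𝔮 = gO then q ∣ N(g) ∣ N(q) = q². Here N(g) = q is impossible,
-- because a² + ab + pb² is a square when b = 0 and at least p - 1/4 > q otherwise; and N(g) = q²
-- would make g an associate of q, although n + ω ∈ 𝔮 is not divisible by q.

module Submission where

open import Defs

open import Level using (0ℓ)
open import Function using (_∘_; flip; id)
open import Function.Bundles using (Equivalence)
open import Function.Definitions using (Injective)
open import Data.Bool using (if_then_else_)
open import Data.Empty using (⊥-elim)
open import Data.Product using (_×_; _,_; ∃; proj₁; proj₂; uncurry)
open import Data.Sum as Sum using (_⊎_; inj₁; inj₂; [_,_]′)
open import Relation.Nullary using (¬_; Dec; yes; no; does)
import Relation.Nullary.Decidable as Dec
open import Relation.Nullary.Negation using (contradiction)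
open import Relation.Binary.Definitions using (tri<; tri≈; tri>)
open import Relation.Binary.Structures using (IsEquivalence)
open import Relation.Binary.Bundles using (Setoid)
import Relation.Binary.Reasoning.Setoid as SetoidReasoning
open import Relation.Binary.PropositionalEquality
  using (_≡_; _≢_; refl; sym; trans; cong; cong₂; subst; setoid; module ≡-Reasoning)
open import Algebra.Bundles using (CommutativeMonoid)

open import Data.Nat as ℕ using (ℕ; zero; suc; _<_; _≤_; _∸_; _<?_; _≤?_; z≤n; s≤s; NonZero)
import Data.Nat.Properties as ℕ
import Data.Nat.Divisibility as ℕ
open import Data.Nat.DivMod
  using (_%_; _/_; m≡m%n+[m/n]*n; m%n<n; m/n*n≤m; m*n/n≡m; /-congˡ; /-monoˡ-≤; m<n*o⇒m/o<n)
open import Data.Nat.Primality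
  using (Prime; euclidsLemma; prime⇒nonZero; prime⇒nonTrivial; prime⇒irreducible; ¬prime[1])
import Data.Nat.Tactic.RingSolver as ℕ-Solver
open import Data.Integer as ℤ using (ℤ; +_; -[1+_]; _+_; _*_; _-_; -_; 0ℤ; 1ℤ; -1ℤ; _^_; ∣_∣)
import Data.Integer.Properties as ℤ
open import Data.Integer.DivMod using (_%ℕ_; _/ℕ_; a≡a%ℕn+[a/ℕn]*n; n%ℕd<d)
open import Data.Integer.Divisibility.Signed
  using (_∣_; _∣?_; divides; ∣ᵤ⇒∣; ∣⇒∣ᵤ; ∣m∣n⇒∣m+n; ∣m⇒∣-m; ∣m⇒∣m*n; ∣n⇒∣m*n)
open import Data.Integer.Tactic.RingSolver using (solve-∀)

open import Data.Fin as Fin using (Fin; punchOut)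
import Data.Fin.Properties as Fin
open import Data.Fin.Permutation using (Permutation′; permutation; _⟨$⟩ʳ_)
open import Data.Vec.Functional using (Vector)
open import Algebra.Properties.CommutativeMonoid.Sum ℕ.+-0-commutativeMonoid
  using (sum; sum-syntax; ∑-comm; ∑-distrib-+) renaming (sum-cong-≗ to ∑-cong)
open import Algebra.Properties.CommutativeMonoid.Sum ℤ.*-1-commutativeMonoid using ()
  renaming (sum to ∏; sum-cong-≗ to ∏-cong; ∑-distrib-+ to ∏-distrib-*; sum-permute to ∏-permute)
import Algebra.Properties.CommutativeMonoid.Sum as CommutativeMonoidSum

open import Data.List using (List; []; _∷_; _++_; [_]; length; applyUpTo)
open import Data.List.Properties using (applyUpTo-∷ʳ; length-applyUpTo)
open import Data.Nat.ListAction using (product)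
open import Data.Nat.ListAction.Properties using (product-↭; product-++)
open import Data.List.Relation.Unary.All as All using (All; _∷_)
open import Data.List.Relation.Unary.Any as Any using (Any; here; there; any?)
import Data.List.Relation.Unary.AllPairs as AllPairs
open import Data.List.Relation.Unary.Unique.Propositional using (Unique)
open import Data.List.Relation.Unary.Unique.Propositional.Properties using (Unique[x∷xs]⇒x∉xs; applyUpTo⁺₁)
open import Data.List.Membership.Propositional using (_∈_; lose)
open import Data.List.Membership.Propositional.Properties using (∈-∃++; ∈-applyUpTo⁺; ∈-applyUpTo⁻)
open import Data.List.Relation.Binary.Permutation.Propositional using (_↭_; ↭-sym; ↭⇒↭ₛ)
open import Data.List.Relation.Binary.Permutation.Propositional.Properties
  using (shift; ∈-resp-↭; All-resp-↭; ↭-length)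
open import Data.List.Relation.Binary.Permutation.Setoid.Properties (setoid ℕ) using (Unique-resp-↭)

-- Congruences modulo m

infix 4 _≡_mod_

-- A record rather than a synonym for + m ∣ a - b, so that a and b can be inferred.
record _≡_mod_ (a b : ℤ) (m : ℕ) : Set where
  constructor mk≡mod
  field ∣-difference : + m ∣ a - b

open _≡_mod_

module _ {m : ℕ} where

  ≡⇒≡-mod : ∀ {a b} → a ≡ b → a ≡ b mod m
  ≡⇒≡-mod {a} refl = mk≡mod (divides 0ℤ (trans (ℤ.+-inverseʳ a) (sym (ℤ.*-zeroˡ (+ m)))))

  ≡-mod-sym : ∀ {a b} → a ≡ b mod m → b ≡ a mod m
  ≡-mod-sym {a} {b} (mk≡mod m∣a-b) = mk≡mod (subst (+ m ∣_) (negate a b) (∣m⇒∣-m m∣a-b))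
    where negate : ∀ a b → - (a - b) ≡ b - a
          negate = solve-∀

  ≡-mod-trans : ∀ {a b c} → a ≡ b mod m → b ≡ c mod m → a ≡ c mod m
  ≡-mod-trans {a} {b} {c} (mk≡mod m∣a-b) (mk≡mod m∣b-c) =
    mk≡mod (subst (+ m ∣_) (telescope a b c) (∣m∣n⇒∣m+n m∣a-b m∣b-c))
    where telescope : ∀ a b c → (a - b) + (b - c) ≡ a - c
          telescope = solve-∀

  ≡-mod-isEquivalence : IsEquivalence (_≡_mod m)
  ≡-mod-isEquivalence = record { refl = ≡⇒≡-mod refl ; sym = ≡-mod-sym ; trans = ≡-mod-trans }

  +-cong-mod : ∀ {a b c d} → a ≡ b mod m → c ≡ d mod m → a + c ≡ b + d mod m
  +-cong-mod {a} {b} {c} {d} (mk≡mod m∣a-b) (mk≡mod m∣c-d) =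
    mk≡mod (subst (+ m ∣_) (regroup a b c d) (∣m∣n⇒∣m+n m∣a-b m∣c-d))
    where regroup : ∀ a b c d → (a - b) + (c - d) ≡ (a + c) - (b + d)
          regroup = solve-∀

  *-cong-mod : ∀ {a b c d} → a ≡ b mod m → c ≡ d mod m → a * c ≡ b * d mod m
  *-cong-mod {a} {b} {c} {d} (mk≡mod m∣a-b) (mk≡mod m∣c-d) =
    mk≡mod (subst (+ m ∣_) (regroup a b c d) (∣m∣n⇒∣m+n (∣m⇒∣m*n c m∣a-b) (∣n⇒∣m*n b m∣c-d)))
    where regroup : ∀ a b c d → (a - b) * c + b * (c - d) ≡ a * c - b * d
          regroup = solve-∀

  *-congˡ-mod : ∀ a {b c} → b ≡ c mod m → a * b ≡ a * c mod m
  *-congˡ-mod a = *-cong-mod (≡⇒≡-mod {a} refl)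

  *-congʳ-mod : ∀ c {a b} → a ≡ b mod m → a * c ≡ b * c mod m
  *-congʳ-mod c a≡b = *-cong-mod a≡b (≡⇒≡-mod {c} refl)

  ∣⇒≡0-mod : ∀ {a} → + m ∣ a → a ≡ 0ℤ mod m
  ∣⇒≡0-mod {a} = mk≡mod ∘ subst (+ m ∣_) (sym (ℤ.+-identityʳ a))

  ≡0-mod⇒∣ : ∀ {a} → a ≡ 0ℤ mod m → + m ∣ a
  ≡0-mod⇒∣ {a} = subst (+ m ∣_) (ℤ.+-identityʳ a) ∘ ∣-difference

≡-mod-setoid : ℕ → Setoid 0ℓ 0ℓ
≡-mod-setoid m = record { isEquivalence = ≡-mod-isEquivalence {m} }

module ≡-mod-Reasoning (m : ℕ) = SetoidReasoning (≡-mod-setoid m)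

≡-mod-%ℕ : ∀ z m .{{_ : NonZero m}} → z ≡ + (z %ℕ m) mod m
≡-mod-%ℕ z m = mk≡mod (divides (z /ℕ m) (begin
  z - + (z %ℕ m)                                ≡⟨ cong (_- + (z %ℕ m)) (a≡a%ℕn+[a/ℕn]*n z m) ⟩
  + (z %ℕ m) + z /ℕ m * + m - + (z %ℕ m)        ≡⟨ cancel (+ (z %ℕ m)) _ ⟩
  z /ℕ m * + m                                  ∎))
  where
  open ≡-Reasoning
  cancel : ∀ x y → x + y - x ≡ y
  cancel = solve-∀

≡-mod? : ∀ m a b → Dec (a ≡ b mod m)
≡-mod? m a b = Dec.map′ mk≡mod ∣-difference (+ m ∣? a - b)

^-cong-mod : ∀ {m a b} n → a ≡ b mod m → a ^ n ≡ b ^ n mod m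
^-cong-mod zero _ = ≡⇒≡-mod refl
^-cong-mod (suc n) a≡b = *-cong-mod a≡b (^-cong-mod n a≡b)

n≡-1-mod-suc : ∀ n → + n ≡ -1ℤ mod suc n
n≡-1-mod-suc n = mk≡mod (divides 1ℤ (trans (cong +_ (ℕ.+-comm n 1)) (sym (ℤ.*-identityˡ (+ suc n)))))

≡-neg-mod⇒∣+ : ∀ {m x y} → x ≡ - y mod m → + m ∣ x + y
≡-neg-mod⇒∣+ {m} {x} {y} (mk≡mod m∣x-[-y]) = subst (+ m ∣_) (minus-neg x y) m∣x-[-y]
  where minus-neg : ∀ x y → x - - y ≡ x + y
        minus-neg = solve-∀

inverse-of-sign : ∀ {m x y s} → s * s ≡ 1ℤ → x * y ≡ 1ℤ mod m → y ≡ s mod m → x ≡ s mod m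
inverse-of-sign {m} {x} {y} {s} s²≡1 xy≡1 y≡s = begin
  x             ≡⟨ ℤ.*-identityʳ x ⟨
  x * 1ℤ        ≡⟨ cong (x *_) s²≡1 ⟨
  x * (s * s)   ≡⟨ ℤ.*-assoc x s s ⟨
  x * s * s     ≈⟨ *-congʳ-mod s (*-congˡ-mod x y≡s) ⟨
  x * y * s     ≈⟨ *-congʳ-mod s xy≡1 ⟩
  1ℤ * s        ≡⟨ ℤ.*-identityˡ s ⟩
  s             ∎
  where open ≡-mod-Reasoning m

*-mod-commutativeMonoid : ℕ → CommutativeMonoid 0ℓ 0ℓ
*-mod-commutativeMonoid m = record
  { _≈_ = _≡_mod m
  ; _∙_ = _*_
  ; ε = 1ℤ
  ; isCommutativeMonoid = record
    { isMonoid = record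
      { isSemigroup = record
        { isMagma = record { isEquivalence = ≡-mod-isEquivalence ; ∙-cong = *-cong-mod }
        ; assoc = λ a b c → ≡⇒≡-mod (ℤ.*-assoc a b c)
        }
      ; identity = (λ a → ≡⇒≡-mod (ℤ.*-identityˡ a)) , (λ a → ≡⇒≡-mod (ℤ.*-identityʳ a))
      }
    ; comm = λ a b → ≡⇒≡-mod (ℤ.*-comm a b)
    }
  }

<∧∣⇒≡0 : ∀ {m d} → d < m → m ℕ.∣ d → d ≡ 0
<∧∣⇒≡0 {d = zero} _ _ = refl
<∧∣⇒≡0 {d = suc _} d<m m∣d = contradiction m∣d (ℕ.>⇒∤ d<m)

0<n<m⇒∤ : ∀ {m n} → 0 < n → n < m → ¬ (+ m ∣ + n)
0<n<m⇒∤ {n = suc _} _ n<m m∣n = ℕ.>⇒∤ n<m (∣⇒∣ᵤ m∣n)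

≡-mod⇒≡ : ∀ {m a b} → a < m → b < m → + a ≡ + b mod m → a ≡ b
≡-mod⇒≡ {m} {a} {b} a<m b<m (mk≡mod m∣a-b) =
  ℤ.+-injective (ℤ.i-j≡0⇒i≡j _ _ (ℤ.∣i∣≡0⇒i≡0 (<∧∣⇒≡0 distance<m (∣⇒∣ᵤ m∣a-b))))
  where
  distance<m : ∣ + a - + b ∣ < m
  distance<m = ℕ.≤-<-trans
    (subst (ℕ._≤ a ℕ.⊔ b) (cong ∣_∣ (sym (ℤ.m-n≡m⊖n a b))) (ℤ.∣m⊝n∣≤m⊔n a b))
    (ℕ.⊔-lub a<m b<m)

module _ {P : ℕ} (P-prime : Prime P) where

  prime∣*⇒∣ : ∀ a b → + P ∣ a * b → (+ P ∣ a) ⊎ (+ P ∣ b)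
  prime∣*⇒∣ a b P∣ab =
    Sum.map ∣ᵤ⇒∣ ∣ᵤ⇒∣ (euclidsLemma ∣ a ∣ ∣ b ∣ P-prime
      (subst (P ℕ.∣_) (ℤ.abs-* a b) (∣⇒∣ᵤ P∣ab)))

  *-cancelʳ-≡-mod : ∀ {a b c} → ¬ (+ P ∣ c) → a * c ≡ b * c mod P → a ≡ b mod P
  *-cancelʳ-≡-mod {a} {b} {c} P∤c (mk≡mod P∣ac-bc) =
    [ mk≡mod , flip contradiction P∤c ]′ (prime∣*⇒∣ (a - b) c (subst (+ P ∣_) (factor a b c) P∣ac-bc))
    where factor : ∀ a b c → a * c - b * c ≡ (a - b) * c
          factor = solve-∀

  square-≡-mod⇒± : ∀ {x y} → x * x ≡ y * y mod P → x ≡ y mod P ⊎ x ≡ - y mod P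
  square-≡-mod⇒± {x} {y} (mk≡mod P∣x²-y²) =
    Sum.map mk≡mod (mk≡mod ∘ subst (+ P ∣_) (plus-as-minus x y))
      (prime∣*⇒∣ (x - y) (x + y) (subst (+ P ∣_) (factor x y) P∣x²-y²))
    where
    factor : ∀ x y → x * x - y * y ≡ (x - y) * (x + y)
    factor = solve-∀
    plus-as-minus : ∀ x y → x + y ≡ x - - y
    plus-as-minus = solve-∀

  ∤-∏ : ∀ {n} (f : Vector ℤ n) → (∀ i → ¬ (+ P ∣ f i)) → ¬ (+ P ∣ ∏ f)
  ∤-∏ {zero} f _ = 0<n<m⇒∤ ℕ.z<s (ℕ.nonTrivial⇒n>1 P {{prime⇒nonTrivial P-prime}})
  ∤-∏ {suc n} f P∤f P∣∏f with prime∣*⇒∣ (f Fin.zero) (∏ (f ∘ Fin.suc)) P∣∏f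
  ... | inj₁ P∣f₀ = P∤f Fin.zero P∣f₀
  ... | inj₂ P∣∏ = ∤-∏ (f ∘ Fin.suc) (P∤f ∘ Fin.suc) P∣∏

odd-prime : ∀ {q} → Prime q → q ≢ 2 → ∃ λ B → q ≡ suc (2 ℕ.* B)
odd-prime {q} q-prime q≢2 with q % 2 | m≡m%n+[m/n]*n q 2 | m%n<n q 2
... | 0 | q≡[q/2]*2 | _ =
  contradiction (prime⇒irreducible q-prime (ℕ.divides (q / 2) q≡[q/2]*2)) [ (λ ()) , q≢2 ∘ sym ]′
... | 1 | q≡1+[q/2]*2 | _ = q / 2 , trans q≡1+[q/2]*2 (cong suc (ℕ.*-comm (q / 2) 2))
... | suc (suc _) | _ | s≤s (s≤s ())

odd-prime>2 : ∀ {B} → Prime (suc (2 ℕ.* B)) → 2 < suc (2 ℕ.* B)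
odd-prime>2 {zero} one-prime = contradiction one-prime ¬prime[1]
odd-prime>2 {suc B} _ = s≤s (ℕ.*-monoʳ-≤ 2 (s≤s z≤n))

∏-cong-mod : ∀ {m n} {f g : Vector ℤ n} → (∀ i → f i ≡ g i mod m) → ∏ f ≡ ∏ g mod m
∏-cong-mod {m} = CommutativeMonoidSum.sum-cong-≋ (*-mod-commutativeMonoid m)

∏-const : ∀ n a → ∏ {n} (λ _ → a) ≡ a ^ n
∏-const zero a = refl
∏-const (suc n) a = cong (a *_) (∏-const n a)

∏-^ : ∀ c {n} (f : Vector ℕ n) → ∏ (λ i → c ^ f i) ≡ c ^ sum f
∏-^ c {zero} f = refl
∏-^ c {suc n} f = trans (cong (c ^ f Fin.zero *_) (∏-^ c (f ∘ Fin.suc)))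
                        (sym (ℤ.^-distribˡ-+-* c (f Fin.zero) (sum (f ∘ Fin.suc))))

^-distribʳ-* : ∀ a b n → (a * b) ^ n ≡ a ^ n * b ^ n
^-distribʳ-* a b zero = refl
^-distribʳ-* a b (suc n) = trans (cong (a * b *_) (^-distribʳ-* a b n)) (interchange a b (a ^ n) (b ^ n))
  where interchange : ∀ a b c d → a * b * (c * d) ≡ a * c * (b * d)
        interchange = solve-∀

-1^n*-1^n≡1 : ∀ n → -1ℤ ^ n * -1ℤ ^ n ≡ 1ℤ
-1^n*-1^n≡1 zero = refl
-1^n*-1^n≡1 (suc n) = trans (square-neg (-1ℤ ^ n)) (-1^n*-1^n≡1 n)
  where square-neg : ∀ x → -1ℤ * x * (-1ℤ * x) ≡ x * x
        square-neg = solve-∀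

2*n≡n+n : ∀ n → 2 ℕ.* n ≡ n ℕ.+ n
2*n≡n+n n = cong (n ℕ.+_) (ℕ.+-identityʳ n)

-1^[2*n]≡1 : ∀ n → -1ℤ ^ (2 ℕ.* n) ≡ 1ℤ
-1^[2*n]≡1 n = begin
  -1ℤ ^ (2 ℕ.* n)          ≡⟨ cong (-1ℤ ^_) (2*n≡n+n n) ⟩
  -1ℤ ^ (n ℕ.+ n)          ≡⟨ ℤ.^-distribˡ-+-* -1ℤ n n ⟩
  -1ℤ ^ n * -1ℤ ^ n        ≡⟨ -1^n*-1^n≡1 n ⟩
  1ℤ                       ∎
  where open ≡-Reasoning

-1^[odd*n]≡-1^n : ∀ j n → -1ℤ ^ (suc (2 ℕ.* j) ℕ.* n) ≡ -1ℤ ^ n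
-1^[odd*n]≡-1^n j n = begin
  -1ℤ ^ (n ℕ.+ 2 ℕ.* j ℕ.* n)         ≡⟨ ℤ.^-distribˡ-+-* -1ℤ n _ ⟩
  -1ℤ ^ n * -1ℤ ^ (2 ℕ.* j ℕ.* n)     ≡⟨ cong (λ e → -1ℤ ^ n * -1ℤ ^ e) (ℕ.*-assoc 2 j n) ⟩
  -1ℤ ^ n * -1ℤ ^ (2 ℕ.* (j ℕ.* n))   ≡⟨ cong (-1ℤ ^ n *_) (-1^[2*n]≡1 (j ℕ.* n)) ⟩
  -1ℤ ^ n * 1ℤ                         ≡⟨ ℤ.*-identityʳ _ ⟩
  -1ℤ ^ n                              ∎
  where open ≡-Reasoning

-1^n≡1⊎-1 : ∀ n → -1ℤ ^ n ≡ 1ℤ ⊎ -1ℤ ^ n ≡ -1ℤ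
-1^n≡1⊎-1 zero = inj₁ refl
-1^n≡1⊎-1 (suc n) with -1^n≡1⊎-1 n
... | inj₁ ≡1 = inj₂ (cong (-1ℤ *_) ≡1)
... | inj₂ ≡-1 = inj₁ (cong (-1ℤ *_) ≡-1)

-1≢1-mod : ∀ {m} → 2 < m → ¬ (-1ℤ ≡ 1ℤ mod m)
-1≢1-mod {m} 2<m -1≡1 = 0<n<m⇒∤ ℕ.z<s 2<m (∣m⇒∣-m {+ m} { -[1+ 1 ]} (∣-difference -1≡1))

-1^n≡1-mod⇒≡1 : ∀ {m} n → 2 < m → -1ℤ ^ n ≡ 1ℤ mod m → -1ℤ ^ n ≡ 1ℤ
-1^n≡1-mod⇒≡1 n 2<m ≡1-mod with -1^n≡1⊎-1 n
... | inj₁ ≡1 = ≡1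
... | inj₂ ≡-1 = contradiction (subst (_≡ 1ℤ mod _) ≡-1 ≡1-mod) (-1≢1-mod 2<m)

injective⇒surjective : ∀ {n} {f : Fin n → Fin n} → Injective _≡_ _≡_ f → ∀ y → ∃ λ x → f x ≡ y
injective⇒surjective {suc n} {f} f-injective y with Fin.any? (λ x → f x Fin.≟ y)
... | yes found = found
... | no none = contradiction (Fin.injective⇒≤ punchOut∘f-injective) ℕ.1+n≰n
  where
  y≢f : ∀ x → y ≢ f x
  y≢f x y≡fx = none (x , sym y≡fx)
  punchOut∘f-injective : Injective _≡_ _≡_ (λ x → punchOut (y≢f x))
  punchOut∘f-injective = f-injective ∘ Fin.punchOut-injective (y≢f _) (y≢f _)

injective⇒permutation : ∀ {n} (f : Fin n → Fin n) → Injective _≡_ _≡_ f → Permutation′ n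
injective⇒permutation f f-injective =
  permutation f (proj₁ ∘ preimage) (proj₂ ∘ preimage) (λ x → f-injective (proj₂ (preimage (f x))))
  where preimage = injective⇒surjective f-injective

s*x*q≡x⇒s≡q : ∀ {s x q} → x * x ≡ 1ℤ → q * q ≡ 1ℤ → s * x * q ≡ x → s ≡ q
s*x*q≡x⇒s≡q {s} {x} {q} x²≡1 q²≡1 sxq≡x = begin
  s                         ≡⟨ ℤ.*-identityʳ s ⟨
  s * 1ℤ                    ≡⟨ cong (s *_) x²≡1 ⟨
  s * (x * x)               ≡⟨ ℤ.*-identityʳ _ ⟨
  s * (x * x) * 1ℤ          ≡⟨ cong (s * (x * x) *_) q²≡1 ⟨
  s * (x * x) * (q * q)     ≡⟨ regroup s x q ⟩
  s * x * q * x * q         ≡⟨ cong (λ y → y * x * q) sxq≡x ⟩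
  x * x * q                 ≡⟨ cong (_* q) x²≡1 ⟩
  1ℤ * q                    ≡⟨ ℤ.*-identityˡ q ⟩
  q                         ∎
  where
  open ≡-Reasoning
  regroup : ∀ s x q → s * (x * x) * (q * q) ≡ s * x * q * x * q
  regroup = solve-∀

positive-index : ∀ {m n} → 0 < m → m ≤ n → ∃ λ (i : Fin n) → suc (Fin.toℕ i) ≡ m
positive-index {suc k} _ k<n = Fin.fromℕ< k<n , cong suc (Fin.toℕ-fromℕ< k<n)

-- Gauss's lemma

module GaussLemma (H a : ℕ) where

  P : ℕ
  P = suc (2 ℕ.* H)

  -- Gauss's half system 1, …, H is indexed by Fin H.
  half : Fin H → ℕ
  half i = suc (Fin.toℕ i)

  residue quotient : Fin H → ℕ
  residue i = a ℕ.* half i % P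
  quotient i = a ℕ.* half i / P

  -- sign r * magnitude r is the absolutely least residue of r modulo P.
  sign : ℕ → ℤ
  sign r with r ℕ.≤? H
  ... | yes _ = 1ℤ
  ... | no _ = -1ℤ

  magnitude : ℕ → ℕ
  magnitude r with r ℕ.≤? H
  ... | yes _ = r
  ... | no _ = P ∸ r

  sign*sign≡1 : ∀ r → sign r * sign r ≡ 1ℤ
  sign*sign≡1 r with r ℕ.≤? H
  ... | yes _ = refl
  ... | no _ = refl

  ≡sign*magnitude : ∀ {r} → r < P → + r ≡ sign r * + magnitude r mod P
  ≡sign*magnitude {r} r<P with r ℕ.≤? H
  ... | yes _ = ≡⇒≡-mod (sym (ℤ.*-identityˡ (+ r)))
  ... | no _ = mk≡mod (divides 1ℤ (begin
    + r - -1ℤ * + (P ∸ r)   ≡⟨ minus-neg (+ r) (+ (P ∸ r)) ⟩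
    + r + + (P ∸ r)          ≡⟨ ℤ.pos-+ r (P ∸ r) ⟨
    + (r ℕ.+ (P ∸ r))        ≡⟨ cong +_ (ℕ.m+[n∸m]≡n (ℕ.<⇒≤ r<P)) ⟩
    + P                      ≡⟨ ℤ.*-identityˡ (+ P) ⟨
    1ℤ * + P                 ∎))
    where
    open ≡-Reasoning
    minus-neg : ∀ x y → x - -1ℤ * y ≡ x + y
    minus-neg = solve-∀

  magnitude-bounds : ∀ {r} → 0 < r → r < P → 0 < magnitude r × magnitude r ≤ H
  magnitude-bounds {r} 0<r r<P with r ℕ.≤? H
  ... | yes r≤H = 0<r , r≤H
  ... | no r≰H = ℕ.m<n⇒0<n∸m r<P , (begin
    P ∸ r                ≤⟨ ℕ.∸-monoʳ-≤ P (ℕ.≰⇒> r≰H) ⟩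
    H ℕ.+ (H ℕ.+ 0) ∸ H  ≡⟨ ℕ.m+n∸m≡n H (H ℕ.+ 0) ⟩
    H ℕ.+ 0              ≡⟨ ℕ.+-identityʳ H ⟩
    H                    ∎)
    where open ℕ.≤-Reasoning

  -1^≡sign*-1^magnitude : ∀ {r} → r < P → -1ℤ ^ r ≡ sign r * -1ℤ ^ magnitude r
  -1^≡sign*-1^magnitude {r} r<P with r ℕ.≤? H
  ... | yes _ = sym (ℤ.*-identityˡ _)
  ... | no _ = begin
    -1ℤ ^ r                      ≡⟨ ℤ.*-identityʳ _ ⟨
    -1ℤ ^ r * 1ℤ                 ≡⟨ cong (-1ℤ ^ r *_) (-1^n*-1^n≡1 s) ⟨
    -1ℤ ^ r * (-1ℤ ^ s * -1ℤ ^ s) ≡⟨ ℤ.*-assoc (-1ℤ ^ r) _ _ ⟨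
    -1ℤ ^ r * -1ℤ ^ s * -1ℤ ^ s  ≡⟨ cong (_* -1ℤ ^ s) (ℤ.^-distribˡ-+-* -1ℤ r s) ⟨
    -1ℤ ^ (r ℕ.+ s) * -1ℤ ^ s    ≡⟨ cong (λ e → -1ℤ ^ e * -1ℤ ^ s) (ℕ.m+[n∸m]≡n (ℕ.<⇒≤ r<P)) ⟩
    -1ℤ * -1ℤ ^ (2 ℕ.* H) * -1ℤ ^ s ≡⟨ cong (λ x → -1ℤ * x * -1ℤ ^ s) (-1^[2*n]≡1 H) ⟩
    -1ℤ * 1ℤ * -1ℤ ^ s           ∎
    where
    open ≡-Reasoning
    s = P ∸ r

  module _ (P-prime : Prime P) (P∤a : ¬ (+ P ∣ + a)) where

    half<P : ∀ i → half i < P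
    half<P i = s≤s (ℕ.≤-trans (Fin.toℕ<n i) (ℕ.m≤m+n H _))

    residue-positive : ∀ i → 0 < residue i
    residue-positive i = ℕ.n≢0⇒n>0 λ residue≡0 →
      [ P∤a ∘ ∣ᵤ⇒∣ , ℕ.>⇒∤ (half<P i) ]′
        (euclidsLemma a (half i) P-prime (ℕ.m%n≡0⇒n∣m (a ℕ.* half i) P residue≡0))

    a*half≡±magnitude : ∀ i → + a * + half i ≡ sign (residue i) * + magnitude (residue i) mod P
    a*half≡±magnitude i = begin
      + a * + half i                             ≡⟨ ℤ.pos-* a (half i) ⟨
      + (a ℕ.* half i)                           ≈⟨ ≡-mod-%ℕ (+ (a ℕ.* half i)) P ⟩
      + residue i                                ≈⟨ ≡sign*magnitude (m%n<n (a ℕ.* half i) P) ⟩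
      sign (residue i) * + magnitude (residue i) ∎
      where open ≡-mod-Reasoning P

    a*x≡a*y⇒x≡y : ∀ {x y} → + a * x ≡ + a * y mod P → x ≡ y mod P
    a*x≡a*y⇒x≡y {x} {y} ax≡ay = *-cancelʳ-≡-mod P-prime P∤a (begin
      x * + a  ≡⟨ ℤ.*-comm x (+ a) ⟩
      + a * x  ≈⟨ ax≡ay ⟩
      + a * y  ≡⟨ ℤ.*-comm (+ a) y ⟩
      y * + a  ∎)
      where open ≡-mod-Reasoning P

    a*half-squared : ∀ i → (+ a * + half i) * (+ a * + half i) ≡ + magnitude (residue i) * + magnitude (residue i) mod P
    a*half-squared i = begin
      (+ a * + half i) * (+ a * + half i)  ≈⟨ *-cong-mod (a*half≡±magnitude i) (a*half≡±magnitude i) ⟩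
      (s * m) * (s * m)                    ≡⟨ regroup s m ⟩
      (s * s) * (m * m)                    ≡⟨ cong (_* (m * m)) (sign*sign≡1 (residue i)) ⟩
      1ℤ * (m * m)                         ≡⟨ ℤ.*-identityˡ (m * m) ⟩
      m * m                                ∎
      where
      open ≡-mod-Reasoning P
      s = sign (residue i)
      m = + magnitude (residue i)
      regroup : ∀ s m → (s * m) * (s * m) ≡ (s * s) * (m * m)
      regroup = solve-∀

    -- a·i ≡ -a·j is impossible because 0 < i + j < P.
    magnitude∘residue-injective : ∀ {i j} → magnitude (residue i) ≡ magnitude (residue j) → i ≡ j
    magnitude∘residue-injective {i} {j} same = [ same-sign , opposite-sign ]′ (square-≡-mod⇒± P-prime squares-agree)
      where
      open ≡-mod-Reasoning P
      squares-agree : (+ a * + half i) * (+ a * + half i) ≡ (+ a * + half j) * (+ a * + half j) mod P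
      squares-agree = begin
        (+ a * + half i) * (+ a * + half i)                ≈⟨ a*half-squared i ⟩
        + magnitude (residue i) * + magnitude (residue i)  ≡⟨ cong (λ m → + m * + m) same ⟩
        + magnitude (residue j) * + magnitude (residue j)  ≈⟨ a*half-squared j ⟨
        (+ a * + half j) * (+ a * + half j)                ∎
      same-sign : + a * + half i ≡ + a * + half j mod P → i ≡ j
      same-sign ai≡aj =
        Fin.toℕ-injective (ℕ.suc-injective (≡-mod⇒≡ (half<P i) (half<P j) (a*x≡a*y⇒x≡y ai≡aj)))
      opposite-sign : + a * + half i ≡ - (+ a * + half j) mod P → i ≡ j
      opposite-sign ai≡-aj = contradiction
        (subst (+ P ∣_) (sym (ℤ.pos-+ (half i) (half j)))
          (≡-neg-mod⇒∣+ (a*x≡a*y⇒x≡y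
            (≡-mod-trans ai≡-aj (≡⇒≡-mod (ℤ.neg-distribʳ-* (+ a) (+ half j)))))))
        (0<n<m⇒∤ ℕ.z<s (s≤s (ℕ.+-mono-≤ (Fin.toℕ<n i) (ℕ.≤-trans (Fin.toℕ<n j) (ℕ.m≤m+n H 0)))))

    private
      index : ∀ i → ∃ λ (k : Fin H) → half k ≡ magnitude (residue i)
      index i = positive-index (proj₁ bounds) (proj₂ bounds)
        where bounds = magnitude-bounds (residue-positive i) (m%n<n (a ℕ.* half i) P)

    magnitude-permutation : Permutation′ H
    magnitude-permutation = injective⇒permutation (proj₁ ∘ index)
      (λ {i} {j} same → magnitude∘residue-injective
        (trans (sym (proj₂ (index i))) (trans (cong half same) (proj₂ (index j)))))

    ∏-magnitude : ∀ (g : ℕ → ℤ) → ∏ (λ i → g (magnitude (residue i))) ≡ ∏ (g ∘ half)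
    ∏-magnitude g = begin
      ∏ (λ i → g (magnitude (residue i)))                 ≡⟨ ∏-cong (λ i → cong g (proj₂ (index i))) ⟨
      ∏ (λ i → g (half (magnitude-permutation ⟨$⟩ʳ i)))   ≡⟨ ∏-permute (g ∘ half) magnitude-permutation ⟨
      ∏ (g ∘ half)                                        ∎
      where open ≡-Reasoning

    gauss-lemma : (+ a) ^ H ≡ ∏ (sign ∘ residue) mod P
    gauss-lemma = *-cancelʳ-≡-mod P-prime (∤-∏ P-prime H! (λ i → 0<n<m⇒∤ ℕ.z<s (half<P i))) (begin
      (+ a) ^ H * ∏ H!                                        ≡⟨ cong (_* ∏ H!) (∏-const H (+ a)) ⟨
      ∏ {H} (λ _ → + a) * ∏ H!                                ≡⟨ ∏-distrib-* (λ _ → + a) H! ⟨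
      ∏ (λ i → + a * + half i)                                ≈⟨ ∏-cong-mod a*half≡±magnitude ⟩
      ∏ (λ i → sign (residue i) * + magnitude (residue i))    ≡⟨ ∏-distrib-* (sign ∘ residue) _ ⟩
      ∏ (sign ∘ residue) * ∏ (λ i → + magnitude (residue i))
        ≡⟨ cong (∏ (sign ∘ residue) *_) (∏-magnitude (λ m → + m)) ⟩
      ∏ (sign ∘ residue) * ∏ H!                               ∎)
      where
      open ≡-mod-Reasoning P
      H! : Fin H → ℤ
      H! i = + half i

    fermat : (+ a) ^ H * (+ a) ^ H ≡ 1ℤ mod P
    fermat = begin
      (+ a) ^ H * (+ a) ^ H                          ≈⟨ *-cong-mod gauss-lemma gauss-lemma ⟩
      ∏ (sign ∘ residue) * ∏ (sign ∘ residue)        ≡⟨ ∏-distrib-* (sign ∘ residue) (sign ∘ residue) ⟨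
      ∏ (λ i → sign (residue i) * sign (residue i))  ≡⟨ ∏-cong (sign*sign≡1 ∘ residue) ⟩
      ∏ {H} (λ _ → 1ℤ)                               ≡⟨ ∏-const H 1ℤ ⟩
      1ℤ ^ H                                         ≡⟨ ℤ.^-zeroˡ H ⟩
      1ℤ                                             ∎
      where open ≡-mod-Reasoning P

    -- Reduce a·i = P·quotient + residue modulo 2, using that a and P are odd.
    eisenstein : ∀ j → a ≡ suc (2 ℕ.* j) → ∏ (sign ∘ residue) ≡ -1ℤ ^ sum quotient
    eisenstein j a-odd = s*x*q≡x⇒s≡q X²≡1 (-1^n*-1^n≡1 (sum quotient)) (sym (begin
      ∏ (λ i → -1ℤ ^ half i)                                  ≡⟨ ∏-cong parity ⟩
      ∏ (λ i → sign (residue i) * -1ℤ ^ magnitude (residue i) * -1ℤ ^ quotient i)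
        ≡⟨ ∏-distrib-* _ (λ i → -1ℤ ^ quotient i) ⟩
      ∏ (λ i → sign (residue i) * -1ℤ ^ magnitude (residue i)) * ∏ (λ i → -1ℤ ^ quotient i)
        ≡⟨ cong (_* ∏ (λ i → -1ℤ ^ quotient i)) (∏-distrib-* (sign ∘ residue) _) ⟩
      ∏ (sign ∘ residue) * ∏ (λ i → -1ℤ ^ magnitude (residue i)) * ∏ (λ i → -1ℤ ^ quotient i)
        ≡⟨ cong₂ (λ x y → ∏ (sign ∘ residue) * x * y) (∏-magnitude (-1ℤ ^_)) (∏-^ -1ℤ quotient) ⟩
      ∏ (sign ∘ residue) * ∏ (λ i → -1ℤ ^ half i) * -1ℤ ^ sum quotient ∎))
      where
      open ≡-Reasoning
      X²≡1 : ∏ (λ i → -1ℤ ^ half i) * ∏ (λ i → -1ℤ ^ half i) ≡ 1ℤ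
      X²≡1 = trans (cong (λ x → x * x) (∏-^ -1ℤ half)) (-1^n*-1^n≡1 (sum half))
      parity : ∀ i → -1ℤ ^ half i ≡ sign (residue i) * -1ℤ ^ magnitude (residue i) * -1ℤ ^ quotient i
      parity i = begin
        -1ℤ ^ half i                                    ≡⟨ -1^[odd*n]≡-1^n j (half i) ⟨
        -1ℤ ^ (suc (2 ℕ.* j) ℕ.* half i)                ≡⟨ cong (λ b → -1ℤ ^ (b ℕ.* half i)) a-odd ⟨
        -1ℤ ^ (a ℕ.* half i)                            ≡⟨ cong (-1ℤ ^_) (m≡m%n+[m/n]*n (a ℕ.* half i) P) ⟩
        -1ℤ ^ (residue i ℕ.+ quotient i ℕ.* P)          ≡⟨ ℤ.^-distribˡ-+-* -1ℤ (residue i) _ ⟩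
        -1ℤ ^ residue i * -1ℤ ^ (quotient i ℕ.* P)
          ≡⟨ cong₂ _*_ (-1^≡sign*-1^magnitude (m%n<n (a ℕ.* half i) P))
                       (trans (cong (-1ℤ ^_) (ℕ.*-comm (quotient i) P)) (-1^[odd*n]≡-1^n H (quotient i))) ⟩
        sign (residue i) * -1ℤ ^ magnitude (residue i) * -1ℤ ^ quotient i ∎

    gauss-eisenstein : ∀ j → a ≡ suc (2 ℕ.* j) → (+ a) ^ H ≡ -1ℤ ^ sum quotient mod P
    gauss-eisenstein j a-odd = ≡-mod-trans gauss-lemma (≡⇒≡-mod (eisenstein j a-odd))

-- Eisenstein's lattice-point count

indicator : ∀ {p} {A : Set p} → Dec A → ℕ
indicator A? = if does A? then 1 else 0

indicator-yes : ∀ {p} {A : Set p} (A? : Dec A) → A → indicator A? ≡ 1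
indicator-yes A? a = cong (λ b → if b then 1 else 0) (Dec.dec-true A? a)

indicator-no : ∀ {p} {A : Set p} (A? : Dec A) → ¬ A → indicator A? ≡ 0
indicator-no A? ¬a = cong (λ b → if b then 1 else 0) (Dec.dec-false A? ¬a)

indicator-<+indicator-> : ∀ {x y} → x ≢ y → indicator (x <? y) ℕ.+ indicator (y <? x) ≡ 1
indicator-<+indicator-> {x} {y} x≢y with ℕ.<-cmp x y
... | tri< x<y _ y≮x = cong₂ ℕ._+_ (indicator-yes (x <? y) x<y) (indicator-no (y <? x) y≮x)
... | tri≈ _ x≡y _   = contradiction x≡y x≢y
... | tri> x≮y _ y<x = cong₂ ℕ._+_ (indicator-no (x <? y) x≮y) (indicator-yes (y <? x) y<x)

∑-const : ∀ n c → ∑[ _ < n ] c ≡ n ℕ.* c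
∑-const zero c = refl
∑-const (suc n) c = cong (c ℕ.+_) (∑-const n c)

∑-indicator-≤ : ∀ {n t} → t ≤ n → ∑[ j < n ] indicator (suc (Fin.toℕ j) ≤? t) ≡ t
∑-indicator-≤ {n} {zero} _ = trans (∑-const n 0) (ℕ.*-zeroʳ n)
∑-indicator-≤ {suc n} {suc t} (s≤s t≤n) = cong suc (∑-indicator-≤ t≤n)

*≤⇒≤/ : ∀ d c y .{{_ : NonZero d}} → d ℕ.* y ≤ c → y ≤ c / d
*≤⇒≤/ d c y dy≤c = begin
  y              ≡⟨ m*n/n≡m y d ⟨
  y ℕ.* d / d    ≡⟨ /-congˡ (ℕ.*-comm y d) ⟩
  d ℕ.* y / d    ≤⟨ /-monoˡ-≤ d dy≤c ⟩
  c / d          ∎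
  where open ℕ.≤-Reasoning

≤/⇒*≤ : ∀ d c y .{{_ : NonZero d}} → y ≤ c / d → d ℕ.* y ≤ c
≤/⇒*≤ d c y y≤c/d = begin
  d ℕ.* y        ≤⟨ ℕ.*-monoʳ-≤ d y≤c/d ⟩
  d ℕ.* (c / d)  ≡⟨ ℕ.*-comm d (c / d) ⟩
  c / d ℕ.* d    ≤⟨ m/n*n≤m c d ⟩
  c              ∎
  where open ℕ.≤-Reasoning

indicator-*<≡indicator-≤/ : ∀ d c y .{{_ : NonZero d}} → d ℕ.* y ≢ c →
                            indicator (d ℕ.* y <? c) ≡ indicator (y ≤? c / d)
indicator-*<≡indicator-≤/ d c y dy≢c with ℕ.<-cmp (d ℕ.* y) c
... | tri< dy<c _ _ =
  trans (indicator-yes (d ℕ.* y <? c) dy<c) (sym (indicator-yes (y ≤? c / d) (*≤⇒≤/ d c y (ℕ.<⇒≤ dy<c))))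
... | tri≈ _ dy≡c _ = contradiction dy≡c dy≢c
... | tri> dy≮c _ c<dy =
  trans (indicator-no (d ℕ.* y <? c) dy≮c) (sym (indicator-no (y ≤? c / d) (ℕ.<⇒≱ c<dy ∘ ≤/⇒*≤ d c y)))

/≡∑-indicator : ∀ d c n .{{_ : NonZero d}} → c / d ≤ n → (∀ (j : Fin n) → d ℕ.* suc (Fin.toℕ j) ≢ c) →
                c / d ≡ ∑[ j < n ] indicator (d ℕ.* suc (Fin.toℕ j) <? c)
/≡∑-indicator d c n c/d≤n d*≢c = begin
  c / d                                              ≡⟨ ∑-indicator-≤ c/d≤n ⟨
  ∑[ j < n ] indicator (suc (Fin.toℕ j) ≤? c / d)
    ≡⟨ ∑-cong (λ j → indicator-*<≡indicator-≤/ d c _ (d*≢c j)) ⟨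
  ∑[ j < n ] indicator (d ℕ.* suc (Fin.toℕ j) <? c)  ∎
  where open ≡-Reasoning

odd*/odd≤ : ∀ A B {x} → x ≤ A → suc (2 ℕ.* B) ℕ.* x / suc (2 ℕ.* A) ≤ B
odd*/odd≤ A B {x} x≤A = ℕ.s≤s⁻¹ (m<n*o⇒m/o<n (begin-strict
  suc (2 ℕ.* B) ℕ.* x                           ≤⟨ ℕ.*-monoʳ-≤ (suc (2 ℕ.* B)) x≤A ⟩
  suc (2 ℕ.* B) ℕ.* A                           <⟨ ℕ.m<m+n _ ℕ.z<s ⟩
  suc (2 ℕ.* B) ℕ.* A ℕ.+ suc (A ℕ.+ B)         ≡⟨ expand A B ⟨
  suc B ℕ.* suc (2 ℕ.* A)                       ∎))
  where
  open ℕ.≤-Reasoning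
  expand : ∀ A B → suc B ℕ.* suc (2 ℕ.* A) ≡ suc (2 ℕ.* B) ℕ.* A ℕ.+ suc (A ℕ.+ B)
  expand = ℕ-Solver.solve-∀

-- Eisenstein's count of the lattice points in the rectangle (0, P/2) × (0, Q/2), split by the diagonal.
lattice-point-count : ∀ A B →
  (∀ (k : Fin A) (j : Fin B) → suc (2 ℕ.* A) ℕ.* suc (Fin.toℕ j) ≢ suc (2 ℕ.* B) ℕ.* suc (Fin.toℕ k)) →
  ∑[ k < A ] (suc (2 ℕ.* B) ℕ.* suc (Fin.toℕ k) / suc (2 ℕ.* A))
    ℕ.+ ∑[ j < B ] (suc (2 ℕ.* A) ℕ.* suc (Fin.toℕ j) / suc (2 ℕ.* B)) ≡ A ℕ.* B
lattice-point-count A B off-diagonal = begin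
  ∑[ k < A ] (Q ℕ.* x k / P) ℕ.+ ∑[ j < B ] (P ℕ.* y j / Q)
    ≡⟨ cong₂ ℕ._+_
         (∑-cong (λ k → /≡∑-indicator P (Q ℕ.* x k) B (odd*/odd≤ A B (Fin.toℕ<n k)) (off-diagonal k)))
         (∑-cong (λ j → /≡∑-indicator Q (P ℕ.* y j) A (odd*/odd≤ B A (Fin.toℕ<n j))
                                      (λ k → off-diagonal k j ∘ sym))) ⟩
  ∑[ k < A ] ∑[ j < B ] below k j ℕ.+ ∑[ j < B ] ∑[ k < A ] above k j
    ≡⟨ cong (∑[ k < A ] ∑[ j < B ] below k j ℕ.+_) (∑-comm above) ⟨
  ∑[ k < A ] ∑[ j < B ] below k j ℕ.+ ∑[ k < A ] ∑[ j < B ] above k j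
    ≡⟨ ∑-distrib-+ (λ k → ∑[ j < B ] below k j) (λ k → ∑[ j < B ] above k j) ⟨
  ∑[ k < A ] (∑[ j < B ] below k j ℕ.+ ∑[ j < B ] above k j)
    ≡⟨ ∑-cong (λ k → ∑-distrib-+ (below k) (above k)) ⟨
  ∑[ k < A ] ∑[ j < B ] (below k j ℕ.+ above k j)
    ≡⟨ ∑-cong (λ k → ∑-cong (λ j → indicator-<+indicator-> (off-diagonal k j))) ⟩
  ∑[ k < A ] ∑[ j < B ] 1
    ≡⟨ ∑-const A (∑[ j < B ] 1) ⟩
  A ℕ.* ∑[ j < B ] 1
    ≡⟨ cong (A ℕ.*_) (trans (∑-const B 1) (ℕ.*-identityʳ B)) ⟩
  A ℕ.* B ∎
  where
  open ≡-Reasoning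
  P Q : ℕ
  P = suc (2 ℕ.* A)
  Q = suc (2 ℕ.* B)
  x : Fin A → ℕ
  x k = suc (Fin.toℕ k)
  y : Fin B → ℕ
  y j = suc (Fin.toℕ j)
  below above : Fin A → Fin B → ℕ
  below k j = indicator (P ℕ.* y j <? Q ℕ.* x k)
  above k j = indicator (Q ℕ.* x k <? P ℕ.* y j)

-- Wilson's theorem and Euler's criterion

NonzeroResidue : ℕ → ℕ → Set
NonzeroResidue m x = 0 < x × x < m

HasPartner : ℕ → ℤ → List ℕ → ℕ → Set
HasPartner m c xs x = ∃ λ y → y ∈ xs × y ≢ x × + x * + y ≡ c mod m

module _ {m : ℕ} (m-prime : Prime m) where

  partner-unique : ∀ {c x y z} → NonzeroResidue m x → NonzeroResidue m y → NonzeroResidue m z →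
                   + x * + y ≡ c mod m → + x * + z ≡ c mod m → y ≡ z
  partner-unique {c} {x} {y} {z} (0<x , x<m) (_ , y<m) (_ , z<m) xy≡c xz≡c =
    ≡-mod⇒≡ y<m z<m (*-cancelʳ-≡-mod m-prime (0<n<m⇒∤ 0<x x<m) (begin
      + y * + x  ≡⟨ ℤ.*-comm (+ y) (+ x) ⟩
      + x * + y  ≈⟨ xy≡c ⟩
      c          ≈⟨ xz≡c ⟨
      + x * + z  ≡⟨ ℤ.*-comm (+ x) (+ z) ⟩
      + z * + x  ∎))
    where open ≡-mod-Reasoning m

  -- Partners are unique, so no element of rest is paired with x or y.
  HasPartner-remove-pair : ∀ {c x y t rest} → Unique (x ∷ t) → t ↭ y ∷ rest → All (NonzeroResidue m) (x ∷ t) →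
                           + x * + y ≡ c mod m → (∀ {z} → z ∈ x ∷ t → HasPartner m c (x ∷ t) z) →
                           ∀ {z} → z ∈ rest → HasPartner m c rest z
  HasPartner-remove-pair {c} {x} {y} {t} {rest} xt-unique t↭y∷rest residues xy≡c partner {z} z∈rest =
    relocate (partner (there z∈t))
    where
    z∈t : z ∈ t
    z∈t = ∈-resp-↭ (↭-sym t↭y∷rest) (there z∈rest)
    y∈t : y ∈ t
    y∈t = ∈-resp-↭ (↭-sym t↭y∷rest) (here refl)
    residue : ∀ {w} → w ∈ x ∷ t → NonzeroResidue m w
    residue = All.lookup residues
    commute : ∀ u v → + u * + v ≡ c mod m → + v * + u ≡ c mod m
    commute u v = ≡-mod-trans (≡⇒≡-mod (ℤ.*-comm (+ v) (+ u)))

    relocate′ : ∀ {z′} → z′ ∈ y ∷ rest → z′ ≢ z → + z * + z′ ≡ c mod m → HasPartner m c rest z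
    relocate′ (here refl) _ zy≡c = contradiction (subst (_∈ t) z≡x z∈t) (Unique[x∷xs]⇒x∉xs xt-unique)
      where z≡x = partner-unique (residue (there y∈t)) (residue (there z∈t)) (residue (here refl))
                                 (commute z y zy≡c) (commute x y xy≡c)
    relocate′ (there z′∈rest) z′≢z zz′≡c = _ , z′∈rest , z′≢z , zz′≡c

    relocate : HasPartner m c (x ∷ t) z → HasPartner m c rest z
    relocate (_ , here refl , _ , zx≡c) = contradiction (subst (_∈ rest) z≡y z∈rest) y∉rest
      where
      z≡y = partner-unique (residue (here refl)) (residue (there z∈t)) (residue (there y∈t))
                           (commute z x zx≡c) xy≡c
      y∉rest = Unique[x∷xs]⇒x∉xs (Unique-resp-↭ (↭⇒↭ₛ t↭y∷rest) (AllPairs.tail xt-unique))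
    relocate (_ , there z′∈t , z′≢z , zz′≡c) = relocate′ (∈-resp-↭ t↭y∷rest z′∈t) z′≢z zz′≡c

  pairing-product : ∀ c k xs → length xs ≡ k ℕ.+ k → Unique xs → All (NonzeroResidue m) xs →
                    (∀ {x} → x ∈ xs → HasPartner m c xs x) → + product xs ≡ c ^ k mod m
  pairing-product c zero [] _ _ _ _ = ≡⇒≡-mod refl
  pairing-product c (suc k) (x ∷ t) |xs| xs-unique residues partner with partner (here refl)
  ... | _ , here refl , y≢x , _ = contradiction refl y≢x
  ... | y , there y∈t , _ , xy≡c with u , w , refl ← ∈-∃++ y∈t = begin
    + (x ℕ.* product t)                ≡⟨ cong (λ p → + (x ℕ.* p)) (product-↭ t↭y∷rest) ⟩
    + (x ℕ.* (y ℕ.* product rest))     ≡⟨ cong +_ (ℕ.*-assoc x y (product rest)) ⟨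
    + (x ℕ.* y ℕ.* product rest)       ≡⟨ trans (ℤ.pos-* (x ℕ.* y) _) (cong (_* + product rest) (ℤ.pos-* x y)) ⟩
    + x * + y * + product rest         ≈⟨ *-cong-mod xy≡c rest-product ⟩
    c * c ^ k                          ∎
    where
    open ≡-mod-Reasoning m
    rest : List ℕ
    rest = u ++ w
    t↭y∷rest : t ↭ y ∷ rest
    t↭y∷rest = shift y u w
    |rest| : length rest ≡ k ℕ.+ k
    |rest| = ℕ.suc-injective (trans (trans (sym (↭-length t↭y∷rest)) (ℕ.suc-injective |xs|)) (ℕ.+-suc k k))
    rest-product : + product rest ≡ c ^ k mod m
    rest-product = pairing-product c k rest |rest|
      (AllPairs.tail (Unique-resp-↭ (↭⇒↭ₛ t↭y∷rest) (AllPairs.tail xs-unique)))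
      (All.tail (All-resp-↭ t↭y∷rest (All.tail residues)))
      (HasPartner-remove-pair xs-unique t↭y∷rest residues xy≡c partner)

divide-mod : ∀ B {c x} → Prime (suc (2 ℕ.* B)) → ¬ (+ suc (2 ℕ.* B) ∣ c) → NonzeroResidue (suc (2 ℕ.* B)) x →
             ∃ λ y → NonzeroResidue (suc (2 ℕ.* B)) y × + x * + y ≡ c mod suc (2 ℕ.* B)
divide-mod zero _ _ (0<x , x<1) = contradiction (ℕ.s≤s⁻¹ x<1) (ℕ.<⇒≱ 0<x)
divide-mod (suc B) {c} {x} Q-prime Q∤c (0<x , x<Q) = y , (ℕ.n≢0⇒n>0 y≢0 , n%ℕd<d z Q) , xy≡c
  where
  Q : ℕ
  Q = suc (2 ℕ.* suc B)
  -- x⁻¹ = x ^ (Q - 2) by Fermat's little theorem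
  z : ℤ
  z = c * ((+ x) ^ B * (+ x) ^ suc B)
  y : ℕ
  y = z %ℕ Q
  xy≡c : + x * + y ≡ c mod Q
  xy≡c = begin
    + x * + y                                ≈⟨ *-congˡ-mod (+ x) (≡-mod-%ℕ z Q) ⟨
    + x * (c * ((+ x) ^ B * (+ x) ^ suc B))  ≡⟨ regroup (+ x) c ((+ x) ^ B) ((+ x) ^ suc B) ⟩
    c * ((+ x) ^ suc B * (+ x) ^ suc B)      ≈⟨ *-congˡ-mod c (GaussLemma.fermat (suc B) x Q-prime Q∤x) ⟩
    c * 1ℤ                                   ≡⟨ ℤ.*-identityʳ c ⟩
    c                                        ∎
    where
    open ≡-mod-Reasoning Q
    Q∤x = 0<n<m⇒∤ 0<x x<Q
    regroup : ∀ x c u v → x * (c * (u * v)) ≡ c * (x * u * v)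
    regroup = solve-∀
  y≢0 : y ≢ 0
  y≢0 y≡0 = Q∤c (≡0-mod⇒∣ (≡-mod-trans (≡-mod-sym xy≡c)
                              (≡⇒≡-mod (trans (cong (λ n → + x * + n) y≡0) (ℤ.*-zeroʳ (+ x))))))

-- The residues 2, …, Q - 2 modulo Q = 2B + 3, i.e. those other than ±1.
module MiddleResidues (B : ℕ) where

  Q-1 Q : ℕ
  Q-1 = 2 ℕ.* suc B
  Q = suc Q-1

  middle : List ℕ
  middle = applyUpTo (2 ℕ.+_) (2 ℕ.* B)

  middle⁻ : ∀ {x} → x ∈ middle → 2 ≤ x × x < Q-1
  middle⁻ x∈middle with i , i<2B , refl ← ∈-applyUpTo⁻ (2 ℕ.+_) x∈middle =
    s≤s (s≤s z≤n) , subst (3 ℕ.+ i ≤_) (sym (ℕ.*-suc 2 B)) (s≤s (s≤s i<2B))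

  middle⁺ : ∀ {x} → 2 ≤ x → x < Q-1 → x ∈ middle
  middle⁺ {suc (suc i)} (s≤s (s≤s z≤n)) x<Q-1 =
    ∈-applyUpTo⁺ (2 ℕ.+_) (ℕ.s≤s⁻¹ (ℕ.s≤s⁻¹ (subst (3 ℕ.+ i ≤_) (ℕ.*-suc 2 B) x<Q-1)))

  middle-residue : ∀ {x} → 2 ≤ x → x < Q-1 → NonzeroResidue Q x
  middle-residue 2≤x x<Q-1 = ℕ.<-trans ℕ.z<s 2≤x , ℕ.<-trans x<Q-1 (ℕ.n<1+n Q-1)

  middle-≢±1 : ∀ {x} → 2 ≤ x → x < Q-1 → ¬ (+ x ≡ 1ℤ mod Q) × ¬ (+ x ≡ -1ℤ mod Q)
  middle-≢±1 {x} 2≤x x<Q-1 =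
    (λ x≡1 → ℕ.<⇒≢ 2≤x (sym (≡-mod⇒≡ (proj₂ (middle-residue 2≤x x<Q-1)) (s≤s (s≤s z≤n)) x≡1))) ,
    (λ x≡-1 → ℕ.<⇒≢ x<Q-1 (≡-mod⇒≡ (proj₂ (middle-residue 2≤x x<Q-1)) (ℕ.n<1+n Q-1)
                                     (≡-mod-trans x≡-1 (≡-mod-sym (n≡-1-mod-suc Q-1)))))

  ±1⊎middle : ∀ {y} → NonzeroResidue Q y → (+ y ≡ 1ℤ mod Q) ⊎ (+ y ≡ -1ℤ mod Q) ⊎ y ∈ middle
  ±1⊎middle {suc zero} _ = inj₁ (≡⇒≡-mod refl)
  ±1⊎middle {suc (suc _)} (_ , y<Q) =
    [ inj₂ ∘ inj₂ ∘ middle⁺ (s≤s (s≤s z≤n))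
    , (λ y≡Q-1 → inj₂ (inj₁ (subst (λ n → + n ≡ -1ℤ mod Q) (sym y≡Q-1) (n≡-1-mod-suc Q-1))))
    ]′ (ℕ.m≤n⇒m<n∨m≡n (ℕ.s≤s⁻¹ y<Q))

  module _ (Q-prime : Prime Q) where

    inverse-partner : ∀ {x} → x ∈ middle → HasPartner Q 1ℤ middle x
    inverse-partner {x} x∈middle = partner (divide-mod (suc B) Q-prime Q∤1 (uncurry middle-residue bounds))
      where
      Q∤1 = 0<n<m⇒∤ ℕ.z<s (s≤s (s≤s z≤n))
      bounds = middle⁻ x∈middle
      x≢1 = proj₁ (uncurry middle-≢±1 bounds)
      x≢-1 = proj₂ (uncurry middle-≢±1 bounds)
      partner : (∃ λ y → NonzeroResidue Q y × + x * + y ≡ 1ℤ mod Q) → HasPartner Q 1ℤ middle x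
      partner (y , y-residue , xy≡1) = y , y∈middle , y≢x , xy≡1
        where
        y∈middle : y ∈ middle
        y∈middle = [ ⊥-elim ∘ x≢1 ∘ inverse-of-sign refl xy≡1
                   , [ ⊥-elim ∘ x≢-1 ∘ inverse-of-sign refl xy≡1 , id ]′ ]′ (±1⊎middle y-residue)
        y≢x : y ≢ x
        y≢x refl = [ x≢1 , x≢-1 ]′ (square-≡-mod⇒± Q-prime xy≡1)

    ∏middle≡1 : + product middle ≡ 1ℤ ^ B mod Q
    ∏middle≡1 = pairing-product Q-prime 1ℤ B middle
      (trans (length-applyUpTo (2 ℕ.+_) (2 ℕ.* B)) (2*n≡n+n B))
      (applyUpTo⁺₁ (2 ℕ.+_) (2 ℕ.* B) (λ i<j _ → ℕ.<⇒≢ (s≤s (s≤s i<j))))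
      (All.tabulate (uncurry middle-residue ∘ middle⁻))
      inverse-partner

-- The factors 2, …, Q - 2 of (Q - 1)! pair off into inverse pairs, leaving 1 · (Q - 1) ≡ -1.
wilson : ∀ B → Prime (suc (2 ℕ.* B)) → + product (applyUpTo suc (2 ℕ.* B)) ≡ -1ℤ mod suc (2 ℕ.* B)
wilson zero one-prime = contradiction one-prime ¬prime[1]
wilson (suc B) Q-prime = begin
  + product (applyUpTo suc Q-1)                   ≡⟨ cong (λ n → + product (applyUpTo suc n)) (ℕ.*-suc 2 B) ⟩
  + product (1 ∷ applyUpTo (2 ℕ.+_) (suc (2 ℕ.* B)))
    ≡⟨ cong (λ xs → + product (1 ∷ xs)) (applyUpTo-∷ʳ (2 ℕ.+_) (2 ℕ.* B)) ⟨
  + product (1 ∷ middle ++ [ 2 ℕ.+ 2 ℕ.* B ])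
    ≡⟨ cong +_ (trans (ℕ.*-identityˡ _) (product-++ middle [ 2 ℕ.+ 2 ℕ.* B ])) ⟩
  + (product middle ℕ.* ((2 ℕ.+ 2 ℕ.* B) ℕ.* 1))
    ≡⟨ cong (λ n → + (product middle ℕ.* n)) (trans (ℕ.*-identityʳ _) (sym (ℕ.*-suc 2 B))) ⟩
  + (product middle ℕ.* Q-1)                      ≡⟨ ℤ.pos-* (product middle) Q-1 ⟩
  + product middle * + Q-1                        ≈⟨ *-cong-mod (∏middle≡1 Q-prime) (n≡-1-mod-suc Q-1) ⟩
  1ℤ ^ B * -1ℤ                                    ≡⟨ cong (_* -1ℤ) (ℤ.^-zeroˡ B) ⟩
  1ℤ * -1ℤ                                        ∎
  where
  open MiddleResidues B
  open ≡-mod-Reasoning Q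

-- Without a square root of b, the residues 1, …, Q - 1 pair off as {x, b/x}, so b^B ≡ (Q - 1)! ≡ -1.
euler-criterion : ∀ B {b} → Prime (suc (2 ℕ.* B)) → ¬ (+ suc (2 ℕ.* B) ∣ b) → b ^ B ≡ 1ℤ mod suc (2 ℕ.* B) →
                  ∃ λ y → y * y ≡ b mod suc (2 ℕ.* B)
euler-criterion B {b} Q-prime Q∤b b^B≡1 = search (any? (λ x → ≡-mod? Q (+ x * + x) b) residues)
  where
  Q : ℕ
  Q = suc (2 ℕ.* B)
  residues : List ℕ
  residues = applyUpTo suc (2 ℕ.* B)

  residues⁻ : ∀ {x} → x ∈ residues → NonzeroResidue Q x
  residues⁻ x∈residues with i , i<2B , refl ← ∈-applyUpTo⁻ suc x∈residues = ℕ.z<s , s≤s i<2B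

  residues⁺ : ∀ {x} → NonzeroResidue Q x → x ∈ residues
  residues⁺ {suc i} (_ , s≤s i<2B) = ∈-applyUpTo⁺ suc i<2B

  search : Dec (Any (λ x → + x * + x ≡ b mod Q) residues) → ∃ λ y → y * y ≡ b mod Q
  search (yes root) = + proj₁ (Any.satisfied root) , proj₂ (Any.satisfied root)
  search (no no-root) = contradiction (≡-mod-trans (≡-mod-sym b^B≡-1) b^B≡1) (-1≢1-mod (odd-prime>2 {B} Q-prime))
    where
    partner : ∀ {x} → x ∈ residues → HasPartner Q b residues x
    partner {x} x∈residues with y , y-residue , xy≡b ← divide-mod B Q-prime Q∤b (residues⁻ x∈residues) =
      y , residues⁺ y-residue , (λ { refl → no-root (lose x∈residues xy≡b) }) , xy≡b
    b^B≡-1 : b ^ B ≡ -1ℤ mod Q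
    b^B≡-1 = ≡-mod-trans
      (≡-mod-sym (pairing-product Q-prime b B residues
        (trans (length-applyUpTo suc (2 ℕ.* B)) (2*n≡n+n B))
        (applyUpTo⁺₁ suc (2 ℕ.* B) (λ i<j _ → ℕ.<⇒≢ (s≤s i<j)))
        (All.tabulate residues⁻)
        partner))
      (wilson B Q-prime)

x²≡b⇒b^H≡1 : ∀ H {b x} → Prime (suc (2 ℕ.* H)) → ¬ (+ suc (2 ℕ.* H) ∣ b) → x * x ≡ b mod suc (2 ℕ.* H) →
             b ^ H ≡ 1ℤ mod suc (2 ℕ.* H)
x²≡b⇒b^H≡1 H {b} {x} P-prime P∤b x²≡b = begin
  b ^ H                    ≈⟨ ^-cong-mod H (≡-mod-trans (≡-mod-sym x²≡b) (*-cong-mod x≡x₀ x≡x₀)) ⟩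
  (+ x₀ * + x₀) ^ H        ≡⟨ ^-distribʳ-* (+ x₀) (+ x₀) H ⟩
  (+ x₀) ^ H * (+ x₀) ^ H  ≈⟨ GaussLemma.fermat H x₀ P-prime P∤x₀ ⟩
  1ℤ                       ∎
  where
  P : ℕ
  P = suc (2 ℕ.* H)
  open ≡-mod-Reasoning P
  x₀ = x %ℕ P
  x≡x₀ = ≡-mod-%ℕ x P
  P∤x₀ : ¬ (+ P ∣ + x₀)
  P∤x₀ P∣x₀ = P∤b (≡0-mod⇒∣ (≡-mod-trans (≡-mod-sym x²≡b) (*-cong-mod x≡0 x≡0)))
    where x≡0 = ≡-mod-trans x≡x₀ (∣⇒≡0-mod P∣x₀)

-- Quadratic reciprocity for ℓ ≡ 3 (mod 4)

-- (q/ℓ) = (-1)^S₁ and (ℓ/q) = (-1)^S₂ by Gauss's lemma, where S₁ + S₂ = A·B counts lattice points;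
-- as A is odd, (q/ℓ) = 1 gives (-ℓ/q) = (-1)^B (ℓ/q) = 1.
module _ (A B : ℕ) where

  private
    ℓ q : ℕ
    ℓ = suc (2 ℕ.* A)
    q = suc (2 ℕ.* B)

  square-mod-ℓ⇒-ℓ-square-mod-q : ∀ {j} → A ≡ suc (2 ℕ.* j) → Prime ℓ → Prime q → q < ℓ →
                                  (∃ λ x → x * x ≡ + q mod ℓ) → ∃ λ y → y * y ≡ - + ℓ mod q
  square-mod-ℓ⇒-ℓ-square-mod-q {j} A-odd ℓ-prime q-prime q<ℓ (x , x²≡q) =
    euler-criterion B q-prime (q∤ℓ ∘ ∣m⇒∣-m) [-ℓ]^B≡1
    where
    S₁ S₂ : ℕ
    S₁ = sum (GaussLemma.quotient A q)
    S₂ = sum (GaussLemma.quotient B ℓ)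

    ℓ∤q : ¬ (+ ℓ ∣ + q)
    ℓ∤q = 0<n<m⇒∤ ℕ.z<s q<ℓ

    q∤ℓ : ¬ (+ q ∣ + ℓ)
    q∤ℓ q∣ℓ = [ (λ q≡1 → ¬prime[1] (subst Prime q≡1 q-prime)) , (λ q≡ℓ → ℕ.<⇒≢ q<ℓ q≡ℓ) ]′
                (prime⇒irreducible ℓ-prime (∣⇒∣ᵤ q∣ℓ))

    -1^S₁≡1 : -1ℤ ^ S₁ ≡ 1ℤ
    -1^S₁≡1 = -1^n≡1-mod⇒≡1 S₁ (odd-prime>2 {A} ℓ-prime)
      (≡-mod-trans (≡-mod-sym (GaussLemma.gauss-eisenstein A q ℓ-prime ℓ∤q B refl))
                   (x²≡b⇒b^H≡1 A {x = x} ℓ-prime ℓ∤q x²≡q))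

    off-diagonal : ∀ (k : Fin A) (j : Fin B) → ℓ ℕ.* suc (Fin.toℕ j) ≢ q ℕ.* suc (Fin.toℕ k)
    off-diagonal k j ℓy≡qx =
      [ ℓ∤q ∘ ∣ᵤ⇒∣ , ℕ.>⇒∤ (s≤s (ℕ.≤-trans (Fin.toℕ<n k) (ℕ.m≤m+n A _))) ]′
        (euclidsLemma q (suc (Fin.toℕ k)) ℓ-prime
          (ℕ.divides (suc (Fin.toℕ j)) (trans (sym ℓy≡qx) (ℕ.*-comm ℓ _))))

    -1^S₂≡-1^B : -1ℤ ^ S₂ ≡ -1ℤ ^ B
    -1^S₂≡-1^B = begin
      -1ℤ ^ S₂                      ≡⟨ ℤ.*-identityˡ _ ⟨
      1ℤ * -1ℤ ^ S₂                 ≡⟨ cong (_* -1ℤ ^ S₂) -1^S₁≡1 ⟨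
      -1ℤ ^ S₁ * -1ℤ ^ S₂           ≡⟨ ℤ.^-distribˡ-+-* -1ℤ S₁ S₂ ⟨
      -1ℤ ^ (S₁ ℕ.+ S₂)             ≡⟨ cong (-1ℤ ^_) (lattice-point-count A B off-diagonal) ⟩
      -1ℤ ^ (A ℕ.* B)               ≡⟨ cong (λ a → -1ℤ ^ (a ℕ.* B)) A-odd ⟩
      -1ℤ ^ (suc (2 ℕ.* j) ℕ.* B)   ≡⟨ -1^[odd*n]≡-1^n j B ⟩
      -1ℤ ^ B                       ∎
      where open ≡-Reasoning

    ℓ^B≡-1^B : (+ ℓ) ^ B ≡ -1ℤ ^ B mod q
    ℓ^B≡-1^B = subst ((+ ℓ) ^ B ≡_mod q) -1^S₂≡-1^B (GaussLemma.gauss-eisenstein B ℓ q-prime q∤ℓ A refl)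

    [-ℓ]^B≡1 : (- + ℓ) ^ B ≡ 1ℤ mod q
    [-ℓ]^B≡1 = begin
      (- + ℓ) ^ B                 ≡⟨ cong (_^ B) (ℤ.-1*i≡-i (+ ℓ)) ⟨
      (-1ℤ * + ℓ) ^ B             ≡⟨ ^-distribʳ-* -1ℤ (+ ℓ) B ⟩
      -1ℤ ^ B * (+ ℓ) ^ B         ≈⟨ *-congˡ-mod (-1ℤ ^ B) ℓ^B≡-1^B ⟩
      -1ℤ ^ B * -1ℤ ^ B           ≡⟨ -1^n*-1^n≡1 B ⟩
      1ℤ                          ∎
      where open ≡-mod-Reasoning q

-- The quadratic order ℤ[ω]

module QuadraticOrder (p : ℕ) where

  norm : O → ℤ
  norm (a , b) = a * a + a * b + + p * (b * b)

  conj : O → O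
  conj (a , b) = a + b , - b

  norm-mulO : ∀ x y → norm (mulO p x y) ≡ norm x * norm y
  norm-mulO (a , b) (c , d) = identity (+ p) a b c d
    where
    identity : ∀ P a b c d →
      (a * c - P * (b * d)) * (a * c - P * (b * d)) + (a * c - P * (b * d)) * (a * d + b * c + b * d)
        + P * ((a * d + b * c + b * d) * (a * d + b * c + b * d))
      ≡ (a * a + a * b + P * (b * b)) * (c * c + c * d + P * (d * d))
    identity = solve-∀

  conj-mulO : ∀ x → mulO p (conj x) x ≡ (norm x , 0ℤ)
  conj-mulO (a , b) = cong₂ _,_ (identity₁ (+ p) a b) (identity₂ a b)
    where
    identity₁ : ∀ P a b → (a + b) * a - P * (- b * b) ≡ a * a + a * b + P * (b * b)
    identity₁ = solve-∀
    identity₂ : ∀ a b → (a + b) * b + - b * a + - b * b ≡ 0ℤ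
    identity₂ = solve-∀

  conj-mulO-mulO : ∀ r g → mulO p (conj r) (mulO p r g) ≡ mulO p (norm r , 0ℤ) g
  conj-mulO-mulO (a , b) (c , d) = cong₂ _,_ (identity₁ (+ p) a b c d) (identity₂ (+ p) a b c d)
    where
    identity₁ : ∀ P a b c d → (a + b) * (a * c - P * (b * d)) - P * (- b * (a * d + b * c + b * d))
                              ≡ (a * a + a * b + P * (b * b)) * c - P * (0ℤ * d)
    identity₁ = solve-∀
    identity₂ : ∀ P a b c d →
      (a + b) * (a * d + b * c + b * d) + - b * (a * c - P * (b * d)) + - b * (a * d + b * c + b * d)
      ≡ (a * a + a * b + P * (b * b)) * d + 0ℤ * c + 0ℤ * d
    identity₂ = solve-∀

  proj₂-mulO-mulO-scalar : ∀ k s t → proj₂ (mulO p s (mulO p t (k , 0ℤ))) ≡ k * proj₂ (mulO p s t)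
  proj₂-mulO-mulO-scalar k (a , b) (c , d) = identity (+ p) k a b c d
    where
    identity : ∀ P k a b c d →
      a * (c * 0ℤ + d * k + d * 0ℤ) + b * (c * k - P * (d * 0ℤ)) + b * (c * 0ℤ + d * k + d * 0ℤ)
      ≡ k * (a * d + b * c + b * d)
    identity = solve-∀

  mulO-identityˡ : ∀ x → mulO p (1ℤ , 0ℤ) x ≡ x
  mulO-identityˡ (a , b) = cong₂ _,_ (identity₁ (+ p) a b) (identity₂ a b)
    where
    identity₁ : ∀ P a b → 1ℤ * a - P * (0ℤ * b) ≡ a
    identity₁ = solve-∀
    identity₂ : ∀ a b → 1ℤ * b + 0ℤ * a + 0ℤ * b ≡ b
    identity₂ = solve-∀

  -- A unit r with r·g = k ∈ ℤ gives g = r̄·k.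
  unit*g≡k⇒k∣proj₂ : ∀ {r g k} → norm r ≡ 1ℤ → mulO p r g ≡ (k , 0ℤ) → ∀ s → k ∣ proj₂ (mulO p s g)
  unit*g≡k⇒k∣proj₂ {r} {g} {k} Nr≡1 rg≡k s =
    divides (proj₂ (mulO p s (conj r))) (trans k-multiple (ℤ.*-comm k _))
    where
    open ≡-Reasoning
    g≡r̄k : g ≡ mulO p (conj r) (k , 0ℤ)
    g≡r̄k = begin
      g                                ≡⟨ mulO-identityˡ g ⟨
      mulO p (1ℤ , 0ℤ) g               ≡⟨ cong (λ n → mulO p (n , 0ℤ) g) Nr≡1 ⟨
      mulO p (norm r , 0ℤ) g           ≡⟨ conj-mulO-mulO r g ⟨
      mulO p (conj r) (mulO p r g)     ≡⟨ cong (mulO p (conj r)) rg≡k ⟩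
      mulO p (conj r) (k , 0ℤ)         ∎
    k-multiple : proj₂ (mulO p s g) ≡ k * proj₂ (mulO p s (conj r))
    k-multiple = trans (cong (proj₂ ∘ mulO p s) g≡r̄k) (proj₂-mulO-mulO-scalar k s (conj r))

  -- The kernel of a + bω ↦ a - b·n (mod q), a ring map since n² + n + p ≡ 0 makes -n a root of ω² - ω + p.
  idealAbove : ∀ q n → + q ∣ n * n + n + + p → Ideal p
  idealAbove q n root = record
    { carrier = λ (a , b) → a ≡ b * n mod q
    ; zero∈ = ≡⇒≡-mod (sym (ℤ.*-zeroˡ n))
    ; +-closed = λ {(a , b)} {(c , d)} a≡bn c≡dn →
        ≡-mod-trans (+-cong-mod a≡bn c≡dn) (≡⇒≡-mod (sym (ℤ.*-distribʳ-+ n b d)))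
    ; *-closed = λ { (c , d) {(a , b)} (mk≡mod q∣a-bn) → mk≡mod (subst (+ q ∣_) (sym (identity (+ p) a b c d n))
                       (∣m∣n⇒∣m+n (∣n⇒∣m*n (c - d * n) q∣a-bn) (∣n⇒∣m*n (- (d * b)) root))) }
    }
    where
    identity : ∀ P a b c d n → (c * a - P * (d * b)) - (c * b + d * a + d * b) * n
                               ≡ (c - d * n) * (a - b * n) + - (d * b) * (n * n + n + P)
    identity = solve-∀

i*i≡+∣i∣*∣i∣ : ∀ x → x * x ≡ + (∣ x ∣ ℕ.* ∣ x ∣)
i*i≡+∣i∣*∣i∣ (+ m) = sym (ℤ.pos-* m m)
i*i≡+∣i∣*∣i∣ -[1+ m ] = refl

prime⇒≢square : ∀ {q} m → Prime q → m ℕ.* m ≢ q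
prime⇒≢square {q} m q-prime m²≡q with prime⇒irreducible q-prime (ℕ.divides m (sym m²≡q))
... | inj₁ refl = ¬prime[1] (subst Prime (sym m²≡q) q-prime)
... | inj₂ refl =
  ¬prime[1] (subst Prime (ℕ.*-cancelʳ-≡ m 1 m {{prime⇒nonZero q-prime}} (trans m²≡q (sym (ℕ.*-identityˡ m)))) q-prime)

prime²-split : ∀ {q m k} → Prime q → m ℕ.* k ≡ q ℕ.* q → q ℕ.∣ k → k ≡ q ⊎ m ≡ 1
prime²-split {q} {m} q-prime mk≡q² (ℕ.divides t refl) =
  Sum.map (λ t≡1 → trans (cong (ℕ._* q) t≡1) (ℕ.*-identityˡ q))
          (λ { refl → ℕ.*-cancelʳ-≡ m 1 q {{q≢0}} (trans mt≡q (sym (ℕ.*-identityˡ q))) })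
          (prime⇒irreducible q-prime (ℕ.divides m (sym mt≡q)))
  where
  q≢0 = prime⇒nonZero q-prime
  mt≡q : m ℕ.* t ≡ q
  mt≡q = ℕ.*-cancelʳ-≡ (m ℕ.* t) q q {{q≢0}} (trans (ℕ.*-assoc m t q) mk≡q²)

module _ (p′ : ℕ) where
  open QuadraticOrder (suc p′)

  4*norm≡ : ∀ a b →
    + 4 * norm (a , b) ≡ + (∣ a + a + b ∣ ℕ.* ∣ a + a + b ∣ ℕ.+ (3 ℕ.+ 4 ℕ.* p′) ℕ.* (∣ b ∣ ℕ.* ∣ b ∣))
  4*norm≡ a b = begin
    + 4 * (a * a + a * b + + suc p′ * (b * b))                ≡⟨ complete-square (+ p′) a b ⟩
    (a + a + b) * (a + a + b) + (+ 3 + + 4 * + p′) * (b * b)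
      ≡⟨ cong (λ c → (a + a + b) * (a + a + b) + c * (b * b)) ℓ≡ ⟨
    (a + a + b) * (a + a + b) + + ℓ * (b * b)
      ≡⟨ cong₂ (λ x y → x + + ℓ * y) (i*i≡+∣i∣*∣i∣ (a + a + b)) (i*i≡+∣i∣*∣i∣ b) ⟩
    + (u ℕ.* u) + + ℓ * + (v ℕ.* v)
      ≡⟨ cong (λ x → + (u ℕ.* u) + x) (ℤ.pos-* ℓ (v ℕ.* v)) ⟨
    + (u ℕ.* u) + + (ℓ ℕ.* (v ℕ.* v))                         ≡⟨ ℤ.pos-+ (u ℕ.* u) _ ⟨
    + (u ℕ.* u ℕ.+ ℓ ℕ.* (v ℕ.* v))                           ∎
    where
    open ≡-Reasoning
    u v ℓ : ℕ
    u = ∣ a + a + b ∣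
    v = ∣ b ∣
    ℓ = 3 ℕ.+ 4 ℕ.* p′
    ℓ≡ : + ℓ ≡ + 3 + + 4 * + p′
    ℓ≡ = trans (ℤ.pos-+ 3 (4 ℕ.* p′)) (cong (λ x → + 3 + x) (ℤ.pos-* 4 p′))
    complete-square : ∀ p′ a b → + 4 * (a * a + a * b + (1ℤ + p′) * (b * b))
                                 ≡ (a + a + b) * (a + a + b) + (+ 3 + + 4 * p′) * (b * b)
    complete-square = solve-∀

  norm≡+∣norm∣ : ∀ x → norm x ≡ + ∣ norm x ∣
  norm≡+∣norm∣ (a , b) = nonnegative (norm (a , b)) (4*norm≡ a b)
    where
    nonnegative : ∀ N {W} → + 4 * N ≡ + W → N ≡ + ∣ N ∣
    nonnegative (+ _) _ = refl

  norm≢prime-b≢0 : ∀ {q} → q ≤ p′ → ∀ a b → 1 ≤ ∣ b ∣ → norm (a , b) ≢ + q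
  norm≢prime-b≢0 {q} q≤p′ a b 1≤v N≡q = ℕ.<⇒≢ 4q<4N (cong (4 ℕ.*_) (sym (cong ∣_∣ N≡q)))
    where
    u v ℓ : ℕ
    u = ∣ a + a + b ∣
    v = ∣ b ∣
    ℓ = 3 ℕ.+ 4 ℕ.* p′
    4N≡ : + (4 ℕ.* ∣ norm (a , b) ∣) ≡ + (u ℕ.* u ℕ.+ ℓ ℕ.* (v ℕ.* v))
    4N≡ = begin
      + (4 ℕ.* ∣ norm (a , b) ∣)  ≡⟨ ℤ.pos-* 4 ∣ norm (a , b) ∣ ⟩
      + 4 * + ∣ norm (a , b) ∣    ≡⟨ cong (+ 4 *_) (norm≡+∣norm∣ (a , b)) ⟨
      + 4 * norm (a , b)          ≡⟨ 4*norm≡ a b ⟩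
      + (u ℕ.* u ℕ.+ ℓ ℕ.* (v ℕ.* v)) ∎
      where open ≡-Reasoning
    4q<4N : 4 ℕ.* q < 4 ℕ.* ∣ norm (a , b) ∣
    4q<4N = begin-strict
      4 ℕ.* q                     ≤⟨ ℕ.*-monoʳ-≤ 4 q≤p′ ⟩
      4 ℕ.* p′                    <⟨ ℕ.m<n+m (4 ℕ.* p′) {3} ℕ.z<s ⟩
      ℓ                           ≡⟨ ℕ.*-identityʳ ℓ ⟨
      ℓ ℕ.* 1                     ≤⟨ ℕ.*-monoʳ-≤ ℓ (ℕ.*-mono-≤ 1≤v 1≤v) ⟩
      ℓ ℕ.* (v ℕ.* v)             ≤⟨ ℕ.m≤n+m _ (u ℕ.* u) ⟩
      u ℕ.* u ℕ.+ ℓ ℕ.* (v ℕ.* v) ≡⟨ ℤ.+-injective 4N≡ ⟨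
      4 ℕ.* ∣ norm (a , b) ∣      ∎
      where open ℕ.≤-Reasoning

  norm≢prime : ∀ {q} → Prime q → q ≤ p′ → ∀ x → norm x ≢ + q
  norm≢prime q-prime q≤p′ (a , + zero) N≡q =
    prime⇒≢square ∣ a ∣ q-prime
      (ℤ.+-injective (trans (sym (i*i≡+∣i∣*∣i∣ a)) (trans (sym (b≡0 (+ suc p′) a)) N≡q)))
    where b≡0 : ∀ P a → a * a + a * 0ℤ + P * (0ℤ * 0ℤ) ≡ a * a
          b≡0 = solve-∀
  norm≢prime q-prime q≤p′ (a , b@(+ suc _)) = norm≢prime-b≢0 q≤p′ a b (s≤s z≤n)
  norm≢prime q-prime q≤p′ (a , b@(-[1+ _ ])) = norm≢prime-b≢0 q≤p′ a b (s≤s z≤n)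

  module _ {q} (q-prime : Prime q) (q≤p′ : q ≤ p′) (n : ℤ) (root : + q ∣ n * n + n + + suc p′) where

    𝔮 : Ideal (suc p′)
    𝔮 = idealAbove q n root

    open Ideal 𝔮

    𝔮-nonprincipal : ¬ IsPrincipal 𝔮
    𝔮-nonprincipal (g , 𝔮≡gO) = [ norm-g≢q , norm-r≢1 ]′ (prime²-split q-prime Nr*Ng≡q² q∣Ng)
      where
      generated : ∀ {x} → carrier x → ∃ λ r → x ≡ mulO (suc p′) r g
      generated {x} = Equivalence.to (𝔮≡gO x)

      q∈𝔮 : carrier (+ q , 0ℤ)
      q∈𝔮 = mk≡mod (divides 1ℤ (identity (+ q) n))
        where identity : ∀ Q n → Q - 0ℤ * n ≡ 1ℤ * Q
              identity = solve-∀

      r = proj₁ (generated q∈𝔮)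
      q≡rg = proj₂ (generated q∈𝔮)
      s = proj₁ (generated {n , 1ℤ} (≡⇒≡-mod (sym (ℤ.*-identityˡ n))))
      n+ω≡sg = proj₂ (generated {n , 1ℤ} (≡⇒≡-mod (sym (ℤ.*-identityˡ n))))

      q∣Ng : q ℕ.∣ ∣ norm g ∣
      q∣Ng = ∣⇒∣ᵤ (≡0-mod⇒∣ (≡-mod-trans Ng∈𝔮 (≡⇒≡-mod (ℤ.*-zeroˡ n))))
        where
        g∈𝔮 = Equivalence.from (𝔮≡gO g) ((1ℤ , 0ℤ) , sym (mulO-identityˡ g))
        Ng∈𝔮 = subst carrier (conj-mulO g) (*-closed (conj g) g∈𝔮)

      Nr*Ng≡q² : ∣ norm r ∣ ℕ.* ∣ norm g ∣ ≡ q ℕ.* q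
      Nr*Ng≡q² = begin
        ∣ norm r ∣ ℕ.* ∣ norm g ∣        ≡⟨ ℤ.abs-* (norm r) (norm g) ⟨
        ∣ norm r * norm g ∣              ≡⟨ cong ∣_∣ (norm-mulO r g) ⟨
        ∣ norm (mulO (suc p′) r g) ∣     ≡⟨ cong (∣_∣ ∘ norm) q≡rg ⟨
        ∣ norm (+ q , 0ℤ) ∣              ≡⟨ cong ∣_∣ (identity (+ suc p′) (+ q)) ⟩
        ∣ + q * + q ∣                    ≡⟨ ℤ.abs-* (+ q) (+ q) ⟩
        q ℕ.* q                          ∎
        where
        open ≡-Reasoning
        identity : ∀ P Q → Q * Q + Q * 0ℤ + P * (0ℤ * 0ℤ) ≡ Q * Q
        identity = solve-∀

      norm-g≢q : ∣ norm g ∣ ≢ q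
      norm-g≢q ∣Ng∣≡q = norm≢prime q-prime q≤p′ g (trans (norm≡+∣norm∣ g) (cong +_ ∣Ng∣≡q))

      norm-r≢1 : ∣ norm r ∣ ≢ 1
      norm-r≢1 ∣Nr∣≡1 = 0<n<m⇒∤ ℕ.z<s (ℕ.nonTrivial⇒n>1 q {{prime⇒nonTrivial q-prime}})
        (subst (+ q ∣_) (cong proj₂ (sym n+ω≡sg))
          (unit*g≡k⇒k∣proj₂ {r} {g} (trans (norm≡+∣norm∣ r) (cong +_ ∣Nr∣≡1)) (sym q≡rg) s))

-- n = (y - 1)(B + 1), as B + 1 is the inverse of 2.
odd-representative : ∀ B y → ∃ λ n → n + n + 1ℤ ≡ y mod suc (2 ℕ.* B)
odd-representative B y = (y - 1ℤ) * (1ℤ + + B) , mk≡mod (divides (y - 1ℤ) (begin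
  (y - 1ℤ) * (1ℤ + + B) + (y - 1ℤ) * (1ℤ + + B) + 1ℤ - y  ≡⟨ identity y (+ B) ⟩
  (y - 1ℤ) * (1ℤ + (+ B + + B))                          ≡⟨ cong (λ b → (y - 1ℤ) * (1ℤ + b)) (ℤ.pos-+ B B) ⟨
  (y - 1ℤ) * + suc (B ℕ.+ B)                              ≡⟨ cong (λ b → (y - 1ℤ) * + suc b) (2*n≡n+n B) ⟨
  (y - 1ℤ) * + suc (2 ℕ.* B)                              ∎))
  where
  open ≡-Reasoning
  identity : ∀ y b → (y - 1ℤ) * (1ℤ + b) + (y - 1ℤ) * (1ℤ + b) + 1ℤ - y ≡ (y - 1ℤ) * (1ℤ + (b + b))
  identity = solve-∀

-- Completing the square: 4(n² + n + P) = (2n + 1)² + (4P - 1).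
root-from-discriminant : ∀ {m n y P} → Prime m → 2 < m →
                         n + n + 1ℤ ≡ y mod m → y * y ≡ - (+ 4 * P - 1ℤ) mod m → + m ∣ n * n + n + P
root-from-discriminant {m} {n} {y} {P} m-prime 2<m 2n+1≡y y²≡1-4P =
  [ ⊥-elim ∘ [ ∤2 , ∤2 ]′ ∘ prime∣*⇒∣ m-prime (+ 2) (+ 2) , id ]′
    (prime∣*⇒∣ m-prime (+ 4) (n * n + n + P) (≡0-mod⇒∣ (begin
    + 4 * (n * n + n + P)                                 ≡⟨ complete-square n P ⟩
    (n + n + 1ℤ) * (n + n + 1ℤ) + (+ 4 * P - 1ℤ)          ≈⟨ +-cong-mod (*-cong-mod 2n+1≡y 2n+1≡y) (≡⇒≡-mod refl) ⟩
    y * y + (+ 4 * P - 1ℤ)                                ≈⟨ +-cong-mod y²≡1-4P (≡⇒≡-mod refl) ⟩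
    - (+ 4 * P - 1ℤ) + (+ 4 * P - 1ℤ)                     ≡⟨ ℤ.+-inverseˡ (+ 4 * P - 1ℤ) ⟩
    0ℤ                                                    ∎)))
  where
  open ≡-mod-Reasoning m
  ∤2 = 0<n<m⇒∤ (s≤s z≤n) 2<m
  complete-square : ∀ n P → + 4 * (n * n + n + P) ≡ (n + n + 1ℤ) * (n + n + 1ℤ) + (+ 4 * P - 1ℤ)
  complete-square = solve-∀

4p-1≡2[2p-1]+1 : ∀ p′ → 4 ℕ.* suc p′ ∸ 1 ≡ suc (2 ℕ.* suc (2 ℕ.* p′))
4p-1≡2[2p-1]+1 p′ = identity p′
  where identity : ∀ p′ → p′ ℕ.+ 3 ℕ.* suc p′ ≡ suc (2 ℕ.* suc (2 ℕ.* p′))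
        identity = ℕ-Solver.solve-∀

p≤4p-1 : ∀ p′ → suc p′ ≤ suc (2 ℕ.* suc (2 ℕ.* p′))
p≤4p-1 p′ = s≤s (ℕ.≤-trans (ℕ.m≤n*m p′ 2) (ℕ.≤-trans (ℕ.n≤1+n _) (ℕ.m≤n*m (suc (2 ℕ.* p′)) 2)))

-- Here p = p′ + 1, ℓ = 4p - 1 = 2A + 1 with A = 2p′ + 1, and q = 2B + 1.
class-number>1 : ∀ p′ B → Prime (suc (2 ℕ.* suc (2 ℕ.* p′))) → Prime (suc (2 ℕ.* B)) → suc (2 ℕ.* B) < suc p′ →
                 (∃ λ x → x * x ≡ + suc (2 ℕ.* B) mod suc (2 ℕ.* suc (2 ℕ.* p′))) → ClassNumberGT1 (suc p′)
class-number>1 p′ B ℓ-prime q-prime q<p q-square =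
  𝔮 p′ q-prime q≤p′ n root , 𝔮-nonprincipal p′ q-prime q≤p′ n root
  where
  q≤p′ = ℕ.s≤s⁻¹ q<p
  -ℓ-square = square-mod-ℓ⇒-ℓ-square-mod-q (suc (2 ℕ.* p′)) B {p′} refl ℓ-prime q-prime
                (ℕ.<-≤-trans q<p (p≤4p-1 p′)) q-square
  y = proj₁ -ℓ-square
  n = proj₁ (odd-representative B y)
  root = root-from-discriminant {n = n} {P = + suc p′} q-prime (odd-prime>2 {B} q-prime)
           (proj₂ (odd-representative B y))
           (subst (λ ℓ → y * y ≡ - + ℓ mod suc (2 ℕ.* B)) (sym (4p-1≡2[2p-1]+1 p′)) (proj₂ -ℓ-square))

lemma6p10 : (p q : ℕ) → Prime p → 5 ≤ p → Prime (4 ℕ.* p ∸ 1) →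
    Prime q → q ≢ 2 → q < p → LegendreIsOne (+ q) (4 ℕ.* p ∸ 1) →
    ClassNumberGT1 p
lemma6p10 (suc p′) q _ _ ℓ-prime q-prime q≢2 q<p (_ , x , ℓ∣x²-q) with B , refl ← odd-prime q-prime q≢2 =
  class-number>1 p′ B (subst Prime (4p-1≡2[2p-1]+1 p′) ℓ-prime) q-prime q<p
    (x , subst (x * x ≡ + q mod_) (4p-1≡2[2p-1]+1 p′) (mk≡mod (∣ᵤ⇒∣ ℓ∣x²-q)))
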